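{- Let $n \ge 1$ and let $G_n$ be the graph with vertex set $\mathbb{Z}^n$ in which $u,v$ are adjacent iff $\|u-v\|_\infty = 1$. Let $S \subset \mathbb{Z}^n$ be finite, let $1 \le i \le n$, and let $S_i$ be the $i$th central compression of $S$. Then $|\partial_e S_i| \le |\partial_e S|$.
   Context: Edges are unordered pairs; for $A \subset \mathbb{Z}^n$, $\partial_e(A) = \{\{x,y\} : \|x-y\|_\infty = 1,\ |A \cap \{x,y\}| = 1\}$. For $p = (p_1,\dots,p_{n-1}) \in \mathbb{Z}^{n-1}$ and $x \in \mathbb{Z}$, write $(p, x \to i) = (p_1,\dots,p_{i-1}, x, p_i, \dots, p_{n-1}) \in \mathbb{Z}^n$ (insert $x$ as the $i$th coordinate). A set $T \subset \mathbb{Z}^n$ is centrally compressed in the $i$th coordinate with respect to $p \in \mathbb{Z}^{n-1}$ if $\{x \in \mathbb{Z} : (p, x\to i) \in T\}$ is empty, or equals $\{x : -a \le x \le a\}$ for some integer $a \ge 0$, or equals $\{x : -a \le x \le a+1\}$ for some integer $a \ge 0$. The $i$th central compression $S_i$ of $S$ is the unique set $S_i \subset \mathbb{Z}^n$ such that for every $p \in \mathbb{Z}^{n-1}$, $|\{x : (p,x\to i) \in S_i\}| = |\{x : (p,x\to i) \in S\}|$ and $S_i$ is centrally compressed in the $i$th coordinate with respect to $p$. -}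

module Defs where

open import Data.Nat as ℕ using (ℕ; _⊔_)
open import Data.Integer as ℤ using (ℤ; +_; -_; _-_; ∣_∣; _≤_)
import Data.Integer.Properties as ℤP
open import Data.Fin using (Fin)
open import Data.Vec using (Vec; []; _∷_; zipWith; foldr; map; insertAt; removeAt)
open import Data.Vec.Properties using (≡-dec)
open import Data.List as List using (List; []; _∷_; length; filter; concatMap; sum)
open import Data.List.Membership.Propositional using (_∈_; _∉_)
import Data.List.Membership.DecPropositional as DecMem
open import Data.Product using (Σ; _×_; _,_)
open import Data.Sum using (_⊎_)
open import Function.Bundles using (_⇔_)
open import Relation.Nullary using (¬_; Dec)
open import Relation.Nullary.Decidable using (_×-dec_; ¬?)
open import Relation.Binary.PropositionalEquality using (_≡_)

Point : ℕ → Set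
Point n = Vec ℤ n

dist∞ : ∀ {n} → Point n → Point n → ℕ
dist∞ x y = foldr (λ _ → ℕ) _⊔_ 0 (map ∣_∣ (zipWith _-_ x y))

box : (n : ℕ) → List (Point n)
box ℕ.zero = [] ∷ []
box (ℕ.suc n) = concatMap (λ d → List.map (d ∷_) (box n)) (- + 1 ∷ + 0 ∷ + 1 ∷ [])

-- Candidates y with ‖x - y‖∞ ≤ 1 (every y with ‖x-y‖∞ = 1 occurs exactly once).
candidates : ∀ {n} → Point n → List (Point n)
candidates {n} x = List.map (zipWith ℤ._+_ x) (box n)

-- Finite subsets of ℤⁿ: duplicate-free lists (membership = set membership).
-- |∂ₑ S|: each edge {x,y} of ∂ₑ S has exactly one endpoint in S, so it is
-- counted once as the ordered pair (x ∈ S, y ∉ S, ‖x - y‖∞ = 1).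
boundaryEdges : ∀ {n} → List (Point n) → List (Point n × Point n)
boundaryEdges {n} S =
  concatMap (λ x → List.map (x ,_)
    (filter (λ y → (dist∞ x y ℕ.≟ 1) ×-dec ¬? (DecMem._∈?_ (≡-dec {n = n} ℤ._≟_) y S)) (candidates x))) S

∣∂ₑ∣ : ∀ {n} → List (Point n) → ℕ
∣∂ₑ∣ S = length (boundaryEdges S)

fibreSize : ∀ {m} → Fin (ℕ.suc m) → Point m → List (Point (ℕ.suc m)) → ℕ
fibreSize i p S = length (filter (λ v → ≡-dec ℤ._≟_ (removeAt v i) p) S)

CentrallyCompressed : ∀ {m} → Fin (ℕ.suc m) → Point m → List (Point (ℕ.suc m)) → Set
CentrallyCompressed i p T =
  (∀ x → insertAt p i x ∉ T)
  ⊎ (Σ ℕ λ a → ∀ x → (insertAt p i x ∈ T) ⇔ ((- + a ≤ x) × (x ≤ + a)))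
  ⊎ (Σ ℕ λ a → ∀ x → (insertAt p i x ∈ T) ⇔ ((- + a ≤ x) × (x ≤ + (ℕ.suc a))))

IsCentralCompression : ∀ {m} → Fin (ℕ.suc m) → List (Point (ℕ.suc m)) → List (Point (ℕ.suc m)) → Set
IsCentralCompression i S T =
  ∀ p → (fibreSize i p T ≡ fibreSize i p S) × CentrallyCompressed i p T

module Submission where

-- Each x ∈ S has 3ⁿ points x + d with d ∈ {-1,0,1}ⁿ, and each of them is either a neighbour outside
-- S (an edge of ∂ₑS) or a point of S, so |∂ₑS| + innerPairs S = 3ⁿ|S|, where innerPairs S counts the
-- pairs (x, d) with x, x + d ∈ S. Compression keeps |S|, so it suffices that it does not decrease
-- innerPairs. Splitting d into its i-th coordinate δ and the rest e, innerPairs S is a sum over e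
-- and over lines p of nearPairs A B = #{(u, δ) : u ∈ A, u + δ ∈ B}, where A and B are the fibres of
-- S over p and p + e. For |A| = a ≤ |B| = b, nearPairs A B is at most 3a − 2, 3a − 1 or 3a according
-- as b − a is 0, 1 or at least 2, because the extreme points of A ∪ B lack neighbours; centred
-- intervals of sizes a and b attain these bounds.

module FiniteSums where

  open import Data.Nat using (ℕ; suc; _+_; _*_; _≤_; _<_; z≤n; s≤s)
  import Data.Nat.Properties as ℕₚ
  open import Data.Nat.Tactic.RingSolver using (solve-∀)
  open import Data.List using (List; []; _∷_; length; filter; concatMap; map; _++_)
  open import Data.List.Membership.Propositional using (_∈_; _∉_)
  import Data.List.Membership.DecPropositional as DecMembership
  open import Data.List.Relation.Binary.Subset.Propositional using (_⊆_)
  open import Data.List.Relation.Unary.Any using (here; there)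
  open import Data.List.Relation.Unary.All.Properties using (All¬⇒¬Any)
  open import Data.List.Relation.Unary.AllPairs using (_∷_)
  open import Data.List.Relation.Unary.Unique.Propositional using (Unique)
  open import Data.Sum using (_⊎_; inj₁; inj₂)
  open import Data.Empty using (⊥-elim)
  open import Level using (Level)
  open import Relation.Nullary using (¬_; Dec; yes; no)
  open import Relation.Unary using (Pred; Decidable)
  open import Relation.Binary.Definitions using (DecidableEquality)
  open import Relation.Binary.PropositionalEquality

  private variable
    a b p q : Level
    A : Set a
    B : Set b

  ∑ : List A → (A → ℕ) → ℕ
  ∑ []       f = 0
  ∑ (x ∷ xs) f = f x + ∑ xs f

  syntax ∑ xs (λ x → e) = ∑[ x ∈ xs ] e

  𝟙 : {P : Set p} → Dec P → ℕ
  𝟙 (yes _) = 1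
  𝟙 (no  _) = 0

  module _ {P : Set p} where

    𝟙-yes : (d : Dec P) → P → 𝟙 d ≡ 1
    𝟙-yes (yes _) _  = refl
    𝟙-yes (no ¬p) p′ = ⊥-elim (¬p p′)

    𝟙-no : (d : Dec P) → ¬ P → 𝟙 d ≡ 0
    𝟙-no (yes p′) ¬p = ⊥-elim (¬p p′)
    𝟙-no (no _)   _  = refl

    𝟙≤1 : (d : Dec P) → 𝟙 d ≤ 1
    𝟙≤1 (yes _) = s≤s z≤n
    𝟙≤1 (no _)  = z≤n

  𝟙-cong : {P : Set p} {Q : Set q} → (P → Q) → (Q → P) → (d : Dec P) (e : Dec Q) → 𝟙 d ≡ 𝟙 e
  𝟙-cong f g (yes p′) e = sym (𝟙-yes e (f p′))
  𝟙-cong f g (no ¬p)  e = sym (𝟙-no e (λ q′ → ¬p (g q′)))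

  ∑-zero : (xs : List A) → ∑[ _ ∈ xs ] 0 ≡ 0
  ∑-zero []       = refl
  ∑-zero (x ∷ xs) = ∑-zero xs

  ∑-+ : (xs : List A) (f g : A → ℕ) → ∑[ x ∈ xs ] (f x + g x) ≡ ∑ xs f + ∑ xs g
  ∑-+ []       f g = refl
  ∑-+ (x ∷ xs) f g rewrite ∑-+ xs f g = interchange (f x) (g x) (∑ xs f) (∑ xs g)
    where
    interchange : ∀ m n k l → m + n + (k + l) ≡ m + k + (n + l)
    interchange = solve-∀

  ∑-cong : (xs : List A) {f g : A → ℕ} → (∀ x → x ∈ xs → f x ≡ g x) → ∑ xs f ≡ ∑ xs g
  ∑-cong []       eq = refl
  ∑-cong (x ∷ xs) eq = cong₂ _+_ (eq x (here refl)) (∑-cong xs (λ y y∈ → eq y (there y∈)))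

  ∑-mono : (xs : List A) {f g : A → ℕ} → (∀ x → x ∈ xs → f x ≤ g x) → ∑ xs f ≤ ∑ xs g
  ∑-mono []       le = z≤n
  ∑-mono (x ∷ xs) le = ℕₚ.+-mono-≤ (le x (here refl)) (∑-mono xs (λ y y∈ → le y (there y∈)))

  ∑-++ : (xs ys : List A) (f : A → ℕ) → ∑ (xs ++ ys) f ≡ ∑ xs f + ∑ ys f
  ∑-++ []       ys f = refl
  ∑-++ (x ∷ xs) ys f rewrite ∑-++ xs ys f = sym (ℕₚ.+-assoc (f x) _ _)

  ∑-map : (h : B → A) (xs : List B) (f : A → ℕ) → ∑ (map h xs) f ≡ ∑[ x ∈ xs ] f (h x)
  ∑-map h []       f = refl
  ∑-map h (x ∷ xs) f = cong (f (h x) +_) (∑-map h xs f)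

  ∑-concatMap : (h : B → List A) (xs : List B) (f : A → ℕ) →
                ∑ (concatMap h xs) f ≡ ∑[ x ∈ xs ] ∑ (h x) f
  ∑-concatMap h []       f = refl
  ∑-concatMap h (x ∷ xs) f =
    trans (∑-++ (h x) (concatMap h xs) f) (cong (∑ (h x) f +_) (∑-concatMap h xs f))

  ∑-const : (xs : List A) (c : ℕ) → ∑[ _ ∈ xs ] c ≡ length xs * c
  ∑-const []       c = refl
  ∑-const (x ∷ xs) c = cong (c +_) (∑-const xs c)

  ∑1≡length : (xs : List A) → ∑[ _ ∈ xs ] 1 ≡ length xs
  ∑1≡length []       = refl
  ∑1≡length (x ∷ xs) = cong suc (∑1≡length xs)

  ∑-comm : (xs : List A) (ys : List B) (f : A → B → ℕ) →
           ∑[ x ∈ xs ] ∑[ y ∈ ys ] f x y ≡ ∑[ y ∈ ys ] ∑[ x ∈ xs ] f x y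
  ∑-comm []       ys f = sym (∑-zero ys)
  ∑-comm (x ∷ xs) ys f =
    trans (cong (∑ ys (f x) +_) (∑-comm xs ys f)) (sym (∑-+ ys (f x) (λ y → ∑[ x′ ∈ xs ] f x′ y)))

  module _ {P : Pred A p} (P? : Decidable P) where

    length-filter : (xs : List A) → length (filter P? xs) ≡ ∑[ x ∈ xs ] 𝟙 (P? x)
    length-filter []       = refl
    length-filter (x ∷ xs) with P? x
    ... | yes _ = cong suc (length-filter xs)
    ... | no  _ = length-filter xs

    ∑-filter : (xs : List A) (f : A → ℕ) → ∑ (filter P? xs) f ≡ ∑[ x ∈ xs ] (𝟙 (P? x) * f x)
    ∑-filter []       f = refl
    ∑-filter (x ∷ xs) f with P? x
    ... | yes _ = cong₂ _+_ (sym (ℕₚ.+-identityʳ (f x))) (∑-filter xs f)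
    ... | no  _ = ∑-filter xs f

    ∑𝟙≤length : (xs : List A) → ∑[ x ∈ xs ] 𝟙 (P? x) ≤ length xs
    ∑𝟙≤length xs = subst (∑[ x ∈ xs ] 𝟙 (P? x) ≤_) (∑1≡length xs) (∑-mono xs (λ x _ → 𝟙≤1 (P? x)))

    ∑𝟙≡length : (xs : List A) → (∀ {x} → x ∈ xs → P x) → ∑[ x ∈ xs ] 𝟙 (P? x) ≡ length xs
    ∑𝟙≡length xs all = trans (∑-cong xs (λ x x∈ → 𝟙-yes (P? x) (all x∈))) (∑1≡length xs)

  module _ (_≟_ : DecidableEquality A) where

    open DecMembership _≟_ using (_∈?_)

    ∑-pick : (xs : List A) → Unique xs → (k : A) (h : A → ℕ) →
             ∑[ x ∈ xs ] (𝟙 (x ≟ k) * h x) ≡ 𝟙 (k ∈? xs) * h k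
    ∑-pick []       _ k h = refl
    ∑-pick (x ∷ xs) (x≢xs ∷ u) k h with x ≟ k
    ... | yes refl = begin
      1 * h x + ∑[ y ∈ xs ] (𝟙 (y ≟ x) * h y) ≡⟨ cong (1 * h x +_) (∑-pick xs u x h) ⟩
      1 * h x + 𝟙 (x ∈? xs) * h x             ≡⟨ cong (λ c → 1 * h x + c * h x) (𝟙-no (x ∈? xs) (All¬⇒¬Any x≢xs)) ⟩
      1 * h x + 0                             ≡⟨ ℕₚ.+-identityʳ (1 * h x) ⟩
      1 * h x                                 ≡⟨ cong (_* h x) (sym (𝟙-yes (x ∈? x ∷ xs) (here refl))) ⟩
      𝟙 (x ∈? x ∷ xs) * h x                   ∎
      where open ≡-Reasoning
    ... | no x≢k = trans (∑-pick xs u k h) (cong (_* h k) (𝟙-cong there drop (k ∈? xs) (k ∈? x ∷ xs)))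
      where
      drop : k ∈ x ∷ xs → k ∈ xs
      drop (here k≡x) = ⊥-elim (x≢k (sym k≡x))
      drop (there k∈) = k∈

    ∑𝟙≟≡𝟙∈ : (xs : List A) → Unique xs → (k : A) → ∑[ x ∈ xs ] 𝟙 (x ≟ k) ≡ 𝟙 (k ∈? xs)
    ∑𝟙≟≡𝟙∈ xs u k = begin
      ∑[ x ∈ xs ] 𝟙 (x ≟ k)       ≡⟨ ∑-cong xs (λ x _ → sym (ℕₚ.*-identityʳ (𝟙 (x ≟ k)))) ⟩
      ∑[ x ∈ xs ] (𝟙 (x ≟ k) * 1) ≡⟨ ∑-pick xs u k (λ _ → 1) ⟩
      𝟙 (k ∈? xs) * 1             ≡⟨ ℕₚ.*-identityʳ (𝟙 (k ∈? xs)) ⟩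
      𝟙 (k ∈? xs)                 ∎
      where open ≡-Reasoning

    ∑𝟙∈-transpose : (xs ys : List A) → Unique xs → Unique ys →
                    (f f⁻¹ : A → A) → (∀ x → f⁻¹ (f x) ≡ x) → (∀ y → f (f⁻¹ y) ≡ y) →
                    ∑[ x ∈ xs ] 𝟙 (f x ∈? ys) ≡ ∑[ y ∈ ys ] 𝟙 (f⁻¹ y ∈? xs)
    ∑𝟙∈-transpose xs ys uxs uys f f⁻¹ f⁻¹∘f f∘f⁻¹ = begin
      ∑[ x ∈ xs ] 𝟙 (f x ∈? ys)
        ≡⟨ ∑-cong xs (λ x _ → sym (∑𝟙≟≡𝟙∈ ys uys (f x))) ⟩
      ∑[ x ∈ xs ] ∑[ y ∈ ys ] 𝟙 (y ≟ f x)
        ≡⟨ ∑-comm xs ys (λ x y → 𝟙 (y ≟ f x)) ⟩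
      ∑[ y ∈ ys ] ∑[ x ∈ xs ] 𝟙 (y ≟ f x)
        ≡⟨ ∑-cong ys (λ y _ → ∑-cong xs (λ x _ → 𝟙-cong (to x y) (from x y) (y ≟ f x) (x ≟ f⁻¹ y))) ⟩
      ∑[ y ∈ ys ] ∑[ x ∈ xs ] 𝟙 (x ≟ f⁻¹ y)
        ≡⟨ ∑-cong ys (λ y _ → ∑𝟙≟≡𝟙∈ xs uxs (f⁻¹ y)) ⟩
      ∑[ y ∈ ys ] 𝟙 (f⁻¹ y ∈? xs)
        ∎
      where
      open ≡-Reasoning
      to : ∀ x y → y ≡ f x → x ≡ f⁻¹ y
      to x y refl = sym (f⁻¹∘f x)
      from : ∀ x y → x ≡ f⁻¹ y → y ≡ f x
      from x y refl = sym (f∘f⁻¹ y)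

    ∑𝟙∈-comm : (xs ys : List A) → Unique xs → Unique ys →
               ∑[ y ∈ ys ] 𝟙 (y ∈? xs) ≡ ∑[ x ∈ xs ] 𝟙 (x ∈? ys)
    ∑𝟙∈-comm xs ys uxs uys = ∑𝟙∈-transpose ys xs uys uxs (λ z → z) (λ z → z) (λ _ → refl) (λ _ → refl)

    ∈⇒1≤∑𝟙≟ : (xs : List A) (k : A) → k ∈ xs → 1 ≤ ∑[ x ∈ xs ] 𝟙 (x ≟ k)
    ∈⇒1≤∑𝟙≟ (x ∷ xs) k (here refl) rewrite 𝟙-yes (x ≟ x) refl = s≤s z≤n
    ∈⇒1≤∑𝟙≟ (x ∷ xs) k (there k∈)  = ℕₚ.≤-trans (∈⇒1≤∑𝟙≟ xs k k∈) (ℕₚ.m≤n+m _ (𝟙 (x ≟ k)))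

    module _ {P : Pred A p} (P? : Decidable P) (xs : List A) where

      ∑𝟙+1≤length : (k : A) → k ∈ xs → ¬ P k → ∑[ x ∈ xs ] 𝟙 (P? x) + 1 ≤ length xs
      ∑𝟙+1≤length k k∈ ¬Pk = begin
        ∑[ x ∈ xs ] 𝟙 (P? x) + 1                        ≤⟨ ℕₚ.+-monoʳ-≤ _ (∈⇒1≤∑𝟙≟ xs k k∈) ⟩
        ∑[ x ∈ xs ] 𝟙 (P? x) + ∑[ x ∈ xs ] 𝟙 (x ≟ k)    ≡⟨ sym (∑-+ xs (λ x → 𝟙 (P? x)) (λ x → 𝟙 (x ≟ k))) ⟩
        ∑[ x ∈ xs ] (𝟙 (P? x) + 𝟙 (x ≟ k))              ≤⟨ ∑-mono xs (λ x _ → atMostOne x) ⟩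
        ∑[ _ ∈ xs ] 1                                   ≡⟨ ∑1≡length xs ⟩
        length xs                                       ∎
        where
        open ℕₚ.≤-Reasoning
        atMostOne : ∀ x → 𝟙 (P? x) + 𝟙 (x ≟ k) ≤ 1
        atMostOne x with x ≟ k
        ... | yes refl rewrite 𝟙-no (P? x) ¬Pk = s≤s z≤n
        ... | no _     = subst (_≤ 1) (sym (ℕₚ.+-identityʳ _)) (𝟙≤1 (P? x))

      ∑𝟙+2≤length : (k l : A) → k ∈ xs → l ∈ xs → k ≢ l → ¬ P k → ¬ P l →
                    ∑[ x ∈ xs ] 𝟙 (P? x) + 2 ≤ length xs
      ∑𝟙+2≤length k l k∈ l∈ k≢l ¬Pk ¬Pl = begin
        ∑[ x ∈ xs ] 𝟙 (P? x) + 2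
          ≤⟨ ℕₚ.+-monoʳ-≤ _ (ℕₚ.+-mono-≤ (∈⇒1≤∑𝟙≟ xs k k∈) (∈⇒1≤∑𝟙≟ xs l l∈)) ⟩
        ∑[ x ∈ xs ] 𝟙 (P? x) + (∑[ x ∈ xs ] 𝟙 (x ≟ k) + ∑[ x ∈ xs ] 𝟙 (x ≟ l))
          ≡⟨ cong (∑[ x ∈ xs ] 𝟙 (P? x) +_) (sym (∑-+ xs (λ x → 𝟙 (x ≟ k)) (λ x → 𝟙 (x ≟ l)))) ⟩
        ∑[ x ∈ xs ] 𝟙 (P? x) + ∑[ x ∈ xs ] (𝟙 (x ≟ k) + 𝟙 (x ≟ l))
          ≡⟨ sym (∑-+ xs (λ x → 𝟙 (P? x)) (λ x → 𝟙 (x ≟ k) + 𝟙 (x ≟ l))) ⟩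
        ∑[ x ∈ xs ] (𝟙 (P? x) + (𝟙 (x ≟ k) + 𝟙 (x ≟ l)))
          ≤⟨ ∑-mono xs (λ x _ → atMostOne x) ⟩
        ∑[ _ ∈ xs ] 1
          ≡⟨ ∑1≡length xs ⟩
        length xs
          ∎
        where
        open ℕₚ.≤-Reasoning
        atMostOne : ∀ x → 𝟙 (P? x) + (𝟙 (x ≟ k) + 𝟙 (x ≟ l)) ≤ 1
        atMostOne x with x ≟ k | x ≟ l
        ... | yes refl | yes refl = ⊥-elim (k≢l refl)
        ... | yes refl | no _ rewrite 𝟙-no (P? x) ¬Pk = s≤s z≤n
        ... | no _ | yes refl rewrite 𝟙-no (P? x) ¬Pl = s≤s z≤n
        ... | no _ | no _ = subst (_≤ 1) (sym (ℕₚ.+-identityʳ _)) (𝟙≤1 (P? x))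

      length≤∑𝟙+1 : Unique xs → (k : A) → (∀ {x} → x ∈ xs → P x ⊎ x ≡ k) →
                    length xs ≤ ∑[ x ∈ xs ] 𝟙 (P? x) + 1
      length≤∑𝟙+1 uxs k P∨≡k = begin
        length xs                                      ≡⟨ sym (∑1≡length xs) ⟩
        ∑[ _ ∈ xs ] 1                                  ≤⟨ ∑-mono xs (λ x x∈ → atLeastOne x (P∨≡k x∈)) ⟩
        ∑[ x ∈ xs ] (𝟙 (P? x) + 𝟙 (x ≟ k))             ≡⟨ ∑-+ xs (λ x → 𝟙 (P? x)) (λ x → 𝟙 (x ≟ k)) ⟩
        ∑[ x ∈ xs ] 𝟙 (P? x) + ∑[ x ∈ xs ] 𝟙 (x ≟ k)   ≡⟨ cong (_ +_) (∑𝟙≟≡𝟙∈ xs uxs k) ⟩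
        ∑[ x ∈ xs ] 𝟙 (P? x) + 𝟙 (k ∈? xs)             ≤⟨ ℕₚ.+-monoʳ-≤ _ (𝟙≤1 (k ∈? xs)) ⟩
        ∑[ x ∈ xs ] 𝟙 (P? x) + 1                       ∎
        where
        open ℕₚ.≤-Reasoning
        atLeastOne : ∀ x → P x ⊎ x ≡ k → 1 ≤ 𝟙 (P? x) + 𝟙 (x ≟ k)
        atLeastOne x (inj₁ Px)  rewrite 𝟙-yes (P? x) Px = s≤s z≤n
        atLeastOne x (inj₂ x≡k) rewrite 𝟙-yes (x ≟ k) x≡k = ℕₚ.m≤n+m 1 _

    module _ (xs ys : List A) (uxs : Unique xs) (uys : Unique ys) where

      private
        ∑𝟙∈≡length : ys ⊆ xs → ∑[ x ∈ xs ] 𝟙 (x ∈? ys) ≡ length ys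
        ∑𝟙∈≡length ys⊆xs =
          trans (sym (∑𝟙∈-comm xs ys uxs uys)) (∑𝟙≡length (_∈? xs) ys ys⊆xs)

      ⊆⇒length≤ : ys ⊆ xs → length ys ≤ length xs
      ⊆⇒length≤ ys⊆xs = subst (_≤ length xs) (∑𝟙∈≡length ys⊆xs) (∑𝟙≤length (_∈? ys) xs)

      ⊂⇒length< : ys ⊆ xs → (k : A) → k ∈ xs → k ∉ ys → length ys < length xs
      ⊂⇒length< ys⊆xs k k∈xs k∉ys = subst (λ n → n ≤ length xs)
        (trans (ℕₚ.+-comm _ 1) (cong suc (∑𝟙∈≡length ys⊆xs))) (∑𝟙+1≤length (_∈? ys) xs k k∈xs k∉ys)

      ⊆∷⇒length≤ : (k : A) → ys ⊆ k ∷ xs → length ys ≤ length xs + 1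
      ⊆∷⇒length≤ k ys⊆k∷xs = begin
        length ys                      ≤⟨ length≤∑𝟙+1 (_∈? xs) ys uys k (λ y∈ → ∈∷⇒ (ys⊆k∷xs y∈)) ⟩
        ∑[ y ∈ ys ] 𝟙 (y ∈? xs) + 1    ≡⟨ cong (_+ 1) (∑𝟙∈-comm xs ys uxs uys) ⟩
        ∑[ x ∈ xs ] 𝟙 (x ∈? ys) + 1    ≤⟨ ℕₚ.+-monoˡ-≤ 1 (∑𝟙≤length (_∈? ys) xs) ⟩
        length xs + 1                  ∎
        where
        open ℕₚ.≤-Reasoning
        ∈∷⇒ : ∀ {y} → y ∈ k ∷ xs → y ∈ xs ⊎ y ≡ k
        ∈∷⇒ (here y≡k)  = inj₂ y≡k
        ∈∷⇒ (there y∈) = inj₁ y∈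

module OneDimensional where

  open FiniteSums
  open import Data.Nat using (ℕ; suc; _+_; _*_; z≤n; s≤s)
    renaming (_≤_ to _≤ℕ_; _<_ to _<ℕ_)
  import Data.Nat.Properties as ℕₚ
  open import Data.Nat.Tactic.RingSolver using (solve-∀)
  open import Data.Integer as ℤ using (ℤ; +_; -_; _≤_; _<_; +≤+)
  import Data.Integer.Properties as ℤₚ
  import Data.Integer.Tactic.RingSolver as ℤSolver
  open import Data.List using (List; []; _∷_; length; _++_)
  open import Data.List.Extrema ℤₚ.≤-totalOrder using (max; min; argmax-sel; argmin-sel; xs≤max; min≤xs)
  open import Data.List.Membership.Propositional using (_∈_; _∉_)
  open import Data.List.Membership.Propositional.Properties using (∈-++⁻; ∈-++⁺ˡ; ∈-++⁺ʳ)
  import Data.List.Membership.DecPropositional as DecMembership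
  open import Data.List.Relation.Binary.Subset.Propositional using (_⊆_)
  open import Data.List.Relation.Unary.Any using (here; there)
  import Data.List.Relation.Unary.All as All
  open import Data.List.Relation.Unary.Unique.Propositional using (Unique)
  open import Data.Product using (_×_; _,_; proj₁; proj₂)
  open import Data.Sum using (_⊎_; inj₁; inj₂; [_,_]′)
  open import Data.Empty using (⊥; ⊥-elim)
  open import Function using (id; _∘_)
  open import Relation.Nullary using (¬_; Dec; yes; no)
  open import Relation.Binary.PropositionalEquality

  open DecMembership ℤ._≟_ using (_∈?_)

  steps : List ℤ
  steps = - + 1 ∷ + 0 ∷ + 1 ∷ []

  links : ℤ → List ℤ → List ℤ → ℕ
  links δ A B = ∑[ u ∈ A ] 𝟙 (u ℤ.+ δ ∈? B)

  nearPairs : List ℤ → List ℤ → ℕ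
  nearPairs A B = ∑[ u ∈ A ] ∑[ δ ∈ steps ] 𝟙 (u ℤ.+ δ ∈? B)

  nearPairs≡∑links : ∀ A B →
    nearPairs A B ≡ links (- + 1) A B + (links (+ 0) A B + links (+ 1) A B)
  nearPairs≡∑links A B = begin
    nearPairs A B
      ≡⟨ ∑-cong A (λ u _ → cong (λ c → hit (- + 1) u + (hit (+ 0) u + c)) (ℕₚ.+-identityʳ _)) ⟩
    ∑[ u ∈ A ] (hit (- + 1) u + (hit (+ 0) u + hit (+ 1) u))
      ≡⟨ ∑-+ A (hit (- + 1)) _ ⟩
    links (- + 1) A B + ∑[ u ∈ A ] (hit (+ 0) u + hit (+ 1) u)
      ≡⟨ cong (_+_ (links (- + 1) A B)) (∑-+ A (hit (+ 0)) (hit (+ 1))) ⟩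
    links (- + 1) A B + (links (+ 0) A B + links (+ 1) A B)
      ∎
    where
    open ≡-Reasoning
    hit : ℤ → ℤ → ℕ
    hit δ u = 𝟙 (u ℤ.+ δ ∈? B)

  module _ {A B : List ℤ} (uA : Unique A) (uB : Unique B) where

    links-swap : ∀ δ → links δ A B ≡ links (- δ) B A
    links-swap δ = ∑𝟙∈-transpose ℤ._≟_ A B uA uB (ℤ._+ δ) (ℤ._+ - δ) (λ u → cancel u δ) (λ v → cancel′ v δ)
      where
      cancel : ∀ u δ → u ℤ.+ δ ℤ.+ - δ ≡ u
      cancel = ℤSolver.solve-∀
      cancel′ : ∀ u δ → u ℤ.+ - δ ℤ.+ δ ≡ u
      cancel′ = ℤSolver.solve-∀

    nearPairs-swap : nearPairs A B ≡ nearPairs B A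
    nearPairs-swap = begin
      nearPairs A B
        ≡⟨ nearPairs≡∑links A B ⟩
      links (- + 1) A B + (links (+ 0) A B + links (+ 1) A B)
        ≡⟨ cong₂ _+_ (links-swap (- + 1)) (cong₂ _+_ (links-swap (+ 0)) (links-swap (+ 1))) ⟩
      links (+ 1) B A + (links (+ 0) B A + links (- + 1) B A)
        ≡⟨ reverse₃ (links (+ 1) B A) (links (+ 0) B A) (links (- + 1) B A) ⟩
      links (- + 1) B A + (links (+ 0) B A + links (+ 1) B A)
        ≡⟨ nearPairs≡∑links B A ⟨
      nearPairs B A
        ∎
      where
      open ≡-Reasoning
      reverse₃ : ∀ a b c → a + (b + c) ≡ c + (b + a)
      reverse₃ = solve-∀

  private
    u≤u+1 : ∀ u → u ≤ u ℤ.+ + 1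
    u≤u+1 u = ℤₚ.i≤i+j u (+ 1)

    u-1≤u : ∀ u → u ℤ.+ - + 1 ≤ u
    u-1≤u u = subst (_≤ u) (ℤₚ.+-comm (- + 1) u) (ℤₚ.i≤j⇒pred[i]≤j ℤₚ.≤-refl)

    u+1≰u : ∀ u → ¬ (u ℤ.+ + 1 ≤ u)
    u+1≰u u le = ℤₚ.<-irrefl refl (ℤₚ.suc[i]≤j⇒i<j (subst (_≤ u) (ℤₚ.+-comm u (+ 1)) le))

    u≰u-1 : ∀ u → ¬ (u ≤ u ℤ.+ - + 1)
    u≰u-1 u le = ℤₚ.<-irrefl refl (ℤₚ.i≤pred[j]⇒i<j (subst (u ≤_) (ℤₚ.+-comm u (- + 1)) le))

    <u+1⇒≤u : ∀ {v u} → v < u ℤ.+ + 1 → v ≤ u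
    <u+1⇒≤u {v} {u} v<u+1 =
      subst (v ≤_) (ℤₚ.pred-suc u) (ℤₚ.i<j⇒i≤pred[j] (subst (v <_) (ℤₚ.+-comm u (+ 1)) v<u+1))

    u-1<⇒u≤ : ∀ {u v} → u ℤ.+ - + 1 < v → u ≤ v
    u-1<⇒u≤ {u} {v} u-1<v =
      subst (_≤ v) (ℤₚ.suc-pred u) (ℤₚ.i<j⇒suc[i]≤j (subst (_< v) (ℤₚ.+-comm u (- + 1)) u-1<v))

    -n≤-m : ∀ {m n} → m ≤ℕ n → - + n ≤ - + m
    -n≤-m m≤n = ℤₚ.neg-mono-≤ (+≤+ m≤n)

    ≤0+ : ∀ {m n} → m ≤ℕ n → m ≤ℕ n + 0
    ≤0+ {n = n} = subst (_ ≤ℕ_) (sym (ℕₚ.+-identityʳ n))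

    ≤+0 : ∀ {m n} → m ≤ℕ n → m + 0 ≤ℕ n
    ≤+0 {m} = subst (_≤ℕ _) (sym (ℕₚ.+-identityʳ m))

    regroup : ∀ a b c i j k → a + i + (b + j + (c + k)) ≡ a + (b + c) + (i + (j + k))
    regroup = solve-∀

    triple : ∀ n → n + (n + n) ≡ 3 * n
    triple = solve-∀

    +-bound₃ : ∀ {a b c n} i j k → a + i ≤ℕ n → b + j ≤ℕ n → c + k ≤ℕ n →
               a + (b + c) + (i + (j + k)) ≤ℕ 3 * n
    +-bound₃ {a} {b} {c} {n} i j k p q r =
      subst₂ _≤ℕ_ (regroup a b c i j k) (triple n) (ℕₚ.+-mono-≤ p (ℕₚ.+-mono-≤ q r))

    +-bound₃′ : ∀ {a b c n} i j k → n ≤ℕ a + i → n ≤ℕ b + j → n ≤ℕ c + k →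
                3 * n ≤ℕ a + (b + c) + (i + (j + k))
    +-bound₃′ {a} {b} {c} {n} i j k p q r =
      subst₂ _≤ℕ_ (triple n) (regroup a b c i j k) (ℕₚ.+-mono-≤ p (ℕₚ.+-mono-≤ q r))

  links≤length : ∀ δ A B → links δ A B ≤ℕ length A
  links≤length δ A B = ∑𝟙≤length (λ u → u ℤ.+ δ ∈? B) A

  links₊-max : ∀ {w} A B → w ∈ A → (∀ {y} → y ∈ B → y ≤ w) → links (+ 1) A B + 1 ≤ℕ length A
  links₊-max A B w∈A B≤w =
    ∑𝟙+1≤length ℤ._≟_ (λ u → u ℤ.+ + 1 ∈? B) A _ w∈A (λ w+1∈B → u+1≰u _ (B≤w w+1∈B))

  links₋-min : ∀ {z} A B → z ∈ A → (∀ {y} → y ∈ B → z ≤ y) → links (- + 1) A B + 1 ≤ℕ length A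
  links₋-min A B z∈A z≤B =
    ∑𝟙+1≤length ℤ._≟_ (λ u → u ℤ.+ - + 1 ∈? B) A _ z∈A (λ z-1∈B → u≰u-1 _ (z≤B z-1∈B))

  private
    +0∉ : ∀ {w B} → w ∉ B → w ℤ.+ + 0 ∉ B
    +0∉ {w} w∉B w+0∈B = w∉B (subst (_∈ _) (ℤₚ.+-identityʳ w) w+0∈B)

  links₀-∉ : ∀ {w} A B → w ∈ A → w ∉ B → links (+ 0) A B + 1 ≤ℕ length A
  links₀-∉ A B w∈A w∉B = ∑𝟙+1≤length ℤ._≟_ (λ u → u ℤ.+ + 0 ∈? B) A _ w∈A (+0∉ w∉B)

  links₀-∉₂ : ∀ {w z} A B → w ∈ A → z ∈ A → w ≢ z → w ∉ B → z ∉ B →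
                links (+ 0) A B + 1 <ℕ length A
  links₀-∉₂ A B w∈A z∈A w≢z w∉B z∉B = subst (_≤ℕ length A) (ℕₚ.+-suc _ 1)
    (∑𝟙+2≤length ℤ._≟_ (λ u → u ℤ.+ + 0 ∈? B) A _ _ w∈A z∈A w≢z (+0∉ w∉B) (+0∉ z∉B))

  nearPairs≤3∣A∣ : ∀ A B → nearPairs A B ≤ℕ 3 * length A
  nearPairs≤3∣A∣ A B = subst₂ _≤ℕ_ (trans (ℕₚ.+-identityʳ _) (sym (nearPairs≡∑links A B))) refl
    (+-bound₃ 0 0 0 (≤+0 (links≤length _ A B)) (≤+0 (links≤length _ A B)) (≤+0 (links≤length _ A B)))

  record Extremes (A B : List ℤ) : Set where
    field
      top bottom : ℤ
      top∈    : top ∈ A ⊎ top ∈ B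
      bottom∈ : bottom ∈ A ⊎ bottom ∈ B
      ≤top    : ∀ {y} → y ∈ A ⊎ y ∈ B → y ≤ top
      bottom≤ : ∀ {y} → y ∈ A ⊎ y ∈ B → bottom ≤ y

  extremes : ∀ {a₀} A B → a₀ ∈ A → Extremes A B
  extremes {a₀} A B a₀∈A = record
    { top     = max a₀ (A ++ B)
    ; bottom  = min a₀ (A ++ B)
    ; top∈    = split (argmax-sel id a₀ (A ++ B))
    ; bottom∈ = split (argmin-sel id a₀ (A ++ B))
    ; ≤top    = All.lookup (xs≤max a₀ (A ++ B)) ∘ join
    ; bottom≤ = All.lookup (min≤xs a₀ (A ++ B)) ∘ join
    }
    where
    split : ∀ {w} → w ≡ a₀ ⊎ w ∈ A ++ B → w ∈ A ⊎ w ∈ B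
    split (inj₁ refl) = inj₁ a₀∈A
    split (inj₂ w∈)   = ∈-++⁻ A w∈
    join : ∀ {y} → y ∈ A ⊎ y ∈ B → y ∈ A ++ B
    join (inj₁ y∈A) = ∈-++⁺ˡ y∈A
    join (inj₂ y∈B) = ∈-++⁺ʳ A y∈B

  private
    resolve : ∀ {w} {A B : List ℤ} → w ∉ A → w ∈ A ⊎ w ∈ B → w ∈ B
    resolve w∉A (inj₁ w∈A) = ⊥-elim (w∉A w∈A)
    resolve w∉A (inj₂ w∈B) = w∈B

  module _ {A B : List ℤ} (uA : Unique A) (uB : Unique B) where

    private
      via-swap : ∀ {n} δ i → links (- δ) B A + i ≤ℕ n → links δ A B + i ≤ℕ n
      via-swap {n} δ i = subst (λ s → s + i ≤ℕ n) (sym (links-swap uA uB δ))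

      ∑links : ℕ
      ∑links = links (- + 1) A B + (links (+ 0) A B + links (+ 1) A B)

      from∑links : ∀ {c} → ∑links + c ≤ℕ 3 * length A → nearPairs A B + c ≤ℕ 3 * length A
      from∑links {c} = subst (λ t → t + c ≤ℕ 3 * length A) (sym (nearPairs≡∑links A B))

    -- A maximum w of A ∪ B costs two links: as w + 1 is in neither set, w is lost from
    -- links (+ 1) A B if w ∈ A and from links (- + 1) A B if w ∈ B; if w lies in only one of
    -- A and B, it is also lost from links (+ 0) A B.
    nearPairs+2≤3∣A∣ : length B ≡ length A → ∀ {a₀} → a₀ ∈ A → nearPairs A B + 2 ≤ℕ 3 * length A
    nearPairs+2≤3∣A∣ ∣B∣≡∣A∣ a₀∈A = from∑links (bound (top ∈? A) (top ∈? B))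
      where
      open Extremes (extremes A B a₀∈A)
      top-of-B : top ∈ B → links (- + 1) A B + 1 ≤ℕ length A
      top-of-B t∈B = via-swap (- + 1) 1 (ℕₚ.≤-trans (links₊-max B A t∈B (≤top ∘ inj₁)) (ℕₚ.≤-reflexive ∣B∣≡∣A∣))
      bound : Dec (top ∈ A) → Dec (top ∈ B) → ∑links + 2 ≤ℕ 3 * length A
      bound (yes t∈A) (yes t∈B) = +-bound₃ 1 0 1
        (top-of-B t∈B) (≤+0 (links≤length _ A B)) (links₊-max A B t∈A (≤top ∘ inj₂))
      bound (yes t∈A) (no t∉B)  = +-bound₃ 0 1 1
        (≤+0 (links≤length _ A B)) (links₀-∉ A B t∈A t∉B) (links₊-max A B t∈A (≤top ∘ inj₂))
      bound (no t∉A)  _         = +-bound₃ 1 1 0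
        (top-of-B t∈B) (via-swap (+ 0) 1 (ℕₚ.≤-trans (links₀-∉ B A t∈B t∉A) (ℕₚ.≤-reflexive ∣B∣≡∣A∣)))
        (≤+0 (links≤length _ A B))
        where t∈B = resolve t∉A top∈

    -- If neither extreme of A ∪ B lies in A, they are two distinct points of B outside A, so
    -- links (+ 0) B A falls two short of |B| = |A| + 1.
    nearPairs+1≤3∣A∣ : length B ≡ suc (length A) → ∀ {a₀} → a₀ ∈ A → nearPairs A B + 1 ≤ℕ 3 * length A
    nearPairs+1≤3∣A∣ ∣B∣≡1+∣A∣ {a₀} a₀∈A = from∑links (bound (top ∈? A) (bottom ∈? A))
      where
      open Extremes (extremes A B a₀∈A)
      bound : Dec (top ∈ A) → Dec (bottom ∈ A) → ∑links + 1 ≤ℕ 3 * length A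
      bound (yes t∈A) _ = +-bound₃ 0 0 1
        (≤+0 (links≤length _ A B)) (≤+0 (links≤length _ A B)) (links₊-max A B t∈A (≤top ∘ inj₂))
      bound (no _) (yes b∈A) = +-bound₃ 1 0 0
        (links₋-min A B b∈A (bottom≤ ∘ inj₂)) (≤+0 (links≤length _ A B)) (≤+0 (links≤length _ A B))
      bound (no t∉A) (no b∉A) = +-bound₃ 0 1 0
        (≤+0 (links≤length _ A B)) (ℕₚ.≤-pred (ℕₚ.≤-trans both-extremes-of-B (ℕₚ.≤-reflexive ∣B∣≡1+∣A∣)))
        (≤+0 (links≤length _ A B))
        where
        t≢b : top ≢ bottom
        t≢b t≡b = t∉A (subst (_∈ A) (sym t≡a₀) a₀∈A)
          where
          t≡a₀ : top ≡ a₀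
          t≡a₀ = ℤₚ.≤-antisym (subst (_≤ a₀) (sym t≡b) (bottom≤ (inj₁ a₀∈A))) (≤top (inj₁ a₀∈A))
        both-extremes-of-B : links (+ 0) A B + 1 <ℕ length B
        both-extremes-of-B = subst (λ s → s + 1 <ℕ length B) (sym (links-swap uA uB (+ 0)))
          (links₀-∉₂ B A (resolve t∉A top∈) (resolve b∉A bottom∈) t≢b t∉A b∉A)

  record CentralInterval (I : List ℤ) : Set where
    field
      left right : ℕ
      right≡   : right ≡ left ⊎ right ≡ suc left
      bounded  : ∀ {u} → u ∈ I → - + left ≤ u × u ≤ + right
      complete : ∀ {u} → - + left ≤ u → u ≤ + right → u ∈ I

    left≤right : left ≤ℕ right
    left≤right = [ ℕₚ.≤-reflexive ∘ sym , (λ eq → ℕₚ.≤-trans (ℕₚ.n≤1+n left) (ℕₚ.≤-reflexive (sym eq))) ]′ right≡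

    right≤1+left : right ≤ℕ suc left
    right≤1+left = [ (λ eq → ℕₚ.≤-trans (ℕₚ.≤-reflexive eq) (ℕₚ.n≤1+n left)) , ℕₚ.≤-reflexive ]′ right≡

    -left∈ : - + left ∈ I
    -left∈ = complete ℤₚ.≤-refl ℤₚ.neg-≤-pos

    right∈ : + right ∈ I
    right∈ = complete ℤₚ.neg-≤-pos ℤₚ.≤-refl

  central-ends : ∀ {x h y k} → x ≤ℕ h → h ≤ℕ suc x → y ≤ℕ k → k ≤ℕ suc y →
                 (x ≤ℕ y × h ≤ℕ k) ⊎ (y <ℕ x × k ≤ℕ h) ⊎ (y ≤ℕ x × k <ℕ h)
  central-ends {x} {h} {y} {k} x≤h h≤1+x y≤k k≤1+y with ℕₚ.≤-<-connex x y | ℕₚ.≤-<-connex h k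
  ... | inj₁ x≤y | inj₁ h≤k = inj₁ (x≤y , h≤k)
  ... | inj₁ _   | inj₂ k<h = inj₂ (inj₂ (ℕₚ.≤-pred (ℕₚ.≤-trans (s≤s y≤k) (ℕₚ.≤-trans k<h h≤1+x)) , k<h))
  ... | inj₂ y<x | _        = inj₂ (inj₁ (y<x , ℕₚ.≤-trans k≤1+y (ℕₚ.≤-trans y<x x≤h)))

  module Intervals {I J : List ℤ} (uI : Unique I) (uJ : Unique J)
                   (cI : CentralInterval I) (cJ : CentralInterval J) where

    open CentralInterval cI using (-left∈; right∈)
      renaming (left to x; right to h; bounded to boundedI; complete to completeI)
    open CentralInterval cJ using ()
      renaming (left to y; right to k; bounded to boundedJ; complete to completeJ)

    J⊆I : y ≤ℕ x → k ≤ℕ h → J ⊆ I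
    J⊆I y≤x k≤h v∈J with boundedJ v∈J
    ... | -y≤v , v≤k = completeI (ℤₚ.≤-trans (-n≤-m y≤x) -y≤v) (ℤₚ.≤-trans v≤k (+≤+ k≤h))

    private
      ¬J⊂I : ∀ {w} → length I ≤ℕ length J → J ⊆ I → w ∈ I → w ∉ J → ⊥
      ¬J⊂I ∣I∣≤∣J∣ J⊆I w∈I w∉J = ℕₚ.<⇒≱ (⊂⇒length< ℤ._≟_ I J uI uJ J⊆I _ w∈I w∉J) ∣I∣≤∣J∣

    ∣I∣≤∣J∣⇒ends≤ : length I ≤ℕ length J → x ≤ℕ y × h ≤ℕ k
    ∣I∣≤∣J∣⇒ends≤ ∣I∣≤∣J∣ with central-ends (CentralInterval.left≤right cI) (CentralInterval.right≤1+left cI)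
                                             (CentralInterval.left≤right cJ) (CentralInterval.right≤1+left cJ)
    ... | inj₁ ends = ends
    ... | inj₂ (inj₁ (y<x , k≤h)) = ⊥-elim (¬J⊂I ∣I∣≤∣J∣ (J⊆I (ℕₚ.<⇒≤ y<x) k≤h) -left∈ -x∉J)
      where
      -x∉J : - + x ∉ J
      -x∉J -x∈J = ℕₚ.<⇒≱ y<x (ℤₚ.drop‿+≤+ (ℤₚ.neg-cancel-≤ (proj₁ (boundedJ -x∈J))))
    ... | inj₂ (inj₂ (y≤x , k<h)) = ⊥-elim (¬J⊂I ∣I∣≤∣J∣ (J⊆I y≤x (ℕₚ.<⇒≤ k<h)) right∈ h∉J)
      where
      h∉J : + h ∉ J
      h∉J h∈J = ℕₚ.<⇒≱ k<h (ℤₚ.drop‿+≤+ (proj₂ (boundedJ h∈J)))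

    module _ (x≤y : x ≤ℕ y) (h≤k : h ≤ℕ k) where

      private
        right-end : ∀ {u} → u ∈ I → u ℤ.+ + 1 ∉ J → + k ≤ u
        right-end {u} u∈I u+1∉J with boundedI u∈I | u ℤ.+ + 1 ℤₚ.≤? + k
        ... | -x≤u , _ | yes u+1≤k =
          ⊥-elim (u+1∉J (completeJ (ℤₚ.≤-trans (-n≤-m x≤y) (ℤₚ.≤-trans -x≤u (u≤u+1 u))) u+1≤k))
        ... | _ | no u+1≰k = <u+1⇒≤u (ℤₚ.≰⇒> u+1≰k)

        left-end : ∀ {u} → u ∈ I → u ℤ.+ - + 1 ∉ J → u ≤ - + y
        left-end {u} u∈I u-1∉J with boundedI u∈I | - + y ℤₚ.≤? u ℤ.+ - + 1
        ... | _ , u≤h | yes -y≤u-1 =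
          ⊥-elim (u-1∉J (completeJ -y≤u-1 (ℤₚ.≤-trans (u-1≤u u) (ℤₚ.≤-trans u≤h (+≤+ h≤k)))))
        ... | _ | no -y≰u-1 = u-1<⇒u≤ (ℤₚ.≰⇒> -y≰u-1)

        linked₀ : ∀ {u} → u ∈ I → u ℤ.+ + 0 ∈ J
        linked₀ {u} u∈I with boundedI u∈I
        ... | -x≤u , u≤h = subst (_∈ J) (sym (ℤₚ.+-identityʳ u))
          (completeJ (ℤₚ.≤-trans (-n≤-m x≤y) -x≤u) (ℤₚ.≤-trans u≤h (+≤+ h≤k)))

        linked₊ : ∀ {u} → u ∈ I → u ℤ.+ + 1 ∈ J ⊎ u ≡ + h
        linked₊ {u} u∈I with u ℤ.+ + 1 ∈? J
        ... | yes u+1∈J = inj₁ u+1∈J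
        ... | no  u+1∉J = inj₂ (ℤₚ.≤-antisym (proj₂ (boundedI u∈I)) (ℤₚ.≤-trans (+≤+ h≤k) (right-end u∈I u+1∉J)))

        linked₊-strict : h <ℕ k → ∀ {u} → u ∈ I → u ℤ.+ + 1 ∈ J
        linked₊-strict h<k {u} u∈I with u ℤ.+ + 1 ∈? J
        ... | yes u+1∈J = u+1∈J
        ... | no  u+1∉J =
          ⊥-elim (ℕₚ.<⇒≱ h<k (ℤₚ.drop‿+≤+ (ℤₚ.≤-trans (right-end u∈I u+1∉J) (proj₂ (boundedI u∈I)))))

        linked₋ : ∀ {u} → u ∈ I → u ℤ.+ - + 1 ∈ J ⊎ u ≡ - + x
        linked₋ {u} u∈I with u ℤ.+ - + 1 ∈? J
        ... | yes u-1∈J = inj₁ u-1∈J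
        ... | no  u-1∉J = inj₂ (ℤₚ.≤-antisym (ℤₚ.≤-trans (left-end u∈I u-1∉J) (-n≤-m x≤y)) (proj₁ (boundedI u∈I)))

        linked₋-strict : x <ℕ y → ∀ {u} → u ∈ I → u ℤ.+ - + 1 ∈ J
        linked₋-strict x<y {u} u∈I with u ℤ.+ - + 1 ∈? J
        ... | yes u-1∈J = u-1∈J
        ... | no  u-1∉J = ⊥-elim (ℕₚ.<⇒≱ x<y
          (ℤₚ.drop‿+≤+ (ℤₚ.neg-cancel-≤ (ℤₚ.≤-trans (proj₁ (boundedI u∈I)) (left-end u∈I u-1∉J)))))

        ∣I∣≤links₀ : length I ≤ℕ links (+ 0) I J
        ∣I∣≤links₀ = ℕₚ.≤-reflexive (sym (∑𝟙≡length (λ u → u ℤ.+ + 0 ∈? J) I linked₀))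

        ∣I∣≤links₊+1 : length I ≤ℕ links (+ 1) I J + 1
        ∣I∣≤links₊+1 = length≤∑𝟙+1 ℤ._≟_ (λ u → u ℤ.+ + 1 ∈? J) I uI (+ h) linked₊

        ∣I∣≤links₊ : h <ℕ k → length I ≤ℕ links (+ 1) I J
        ∣I∣≤links₊ h<k = ℕₚ.≤-reflexive (sym (∑𝟙≡length (λ u → u ℤ.+ + 1 ∈? J) I (linked₊-strict h<k)))

        ∣I∣≤links₋+1 : length I ≤ℕ links (- + 1) I J + 1
        ∣I∣≤links₋+1 = length≤∑𝟙+1 ℤ._≟_ (λ u → u ℤ.+ - + 1 ∈? J) I uI (- + x) linked₋

        ∣I∣≤links₋ : x <ℕ y → length I ≤ℕ links (- + 1) I J
        ∣I∣≤links₋ x<y = ℕₚ.≤-reflexive (sym (∑𝟙≡length (λ u → u ℤ.+ - + 1 ∈? J) I (linked₋-strict x<y)))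

        from∑links : ∀ {c} → 3 * length I ≤ℕ links (- + 1) I J + (links (+ 0) I J + links (+ 1) I J) + c →
                     3 * length I ≤ℕ nearPairs I J + c
        from∑links {c} = subst (λ t → 3 * length I ≤ℕ t + c) (sym (nearPairs≡∑links I J))

        ¬J⊆∷I : 2 + length I ≤ℕ length J → ∀ w → J ⊆ w ∷ I → ⊥
        ¬J⊆∷I 2+∣I∣≤∣J∣ w J⊆w∷I = ℕₚ.<⇒≱ 2+∣I∣≤∣J∣
          (subst (length J ≤ℕ_) (ℕₚ.+-comm (length I) 1) (⊆∷⇒length≤ ℤ._≟_ I J uI uJ w J⊆w∷I))

        J⊆k∷I : x ≡ y → J ⊆ + k ∷ I
        J⊆k∷I x≡y {v} v∈J with boundedJ v∈J | v ℤₚ.≤? + h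
        ... | -y≤v , _   | yes v≤h = there (completeI (subst (λ n → - + n ≤ v) (sym x≡y) -y≤v) v≤h)
        ... | _ , v≤k    | no  v≰h =
          here (ℤₚ.≤-antisym v≤k (ℤₚ.≤-trans (+≤+ k≤1+h) (ℤₚ.i<j⇒suc[i]≤j (ℤₚ.≰⇒> v≰h))))
          where
          k≤1+h : k ≤ℕ suc h
          k≤1+h = ℕₚ.≤-trans (CentralInterval.right≤1+left cJ)
                    (s≤s (ℕₚ.≤-trans (ℕₚ.≤-reflexive (sym x≡y)) (CentralInterval.left≤right cI)))

        J⊆-y∷I : h ≡ k → J ⊆ - + y ∷ I
        J⊆-y∷I h≡k {v} v∈J with boundedJ v∈J | - + x ℤₚ.≤? v
        ... | _ , v≤k    | yes -x≤v = there (completeI -x≤v (subst (λ n → v ≤ + n) (sym h≡k) v≤k))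
        ... | -y≤v , _   | no  -x≰v = here (ℤₚ.≤-antisym v≤-y -y≤v)
          where
          y≤1+x : y ≤ℕ suc x
          y≤1+x = ℕₚ.≤-trans (CentralInterval.left≤right cJ)
                    (ℕₚ.≤-trans (ℕₚ.≤-reflexive (sym h≡k)) (CentralInterval.right≤1+left cI))
          v≤-y : v ≤ - + y
          v≤-y = ℤₚ.≤-trans (subst (v ≤_) (sym (ℤₚ.neg-suc x)) (ℤₚ.i<j⇒i≤pred[j] (ℤₚ.≰⇒> -x≰v))) (-n≤-m y≤1+x)

      3∣I∣≤nearPairs+2 : 3 * length I ≤ℕ nearPairs I J + 2
      3∣I∣≤nearPairs+2 = from∑links (+-bound₃′ 1 0 1 ∣I∣≤links₋+1 (≤0+ ∣I∣≤links₀) ∣I∣≤links₊+1)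

      3∣I∣≤nearPairs+1 : length J ≡ suc (length I) → 3 * length I ≤ℕ nearPairs I J + 1
      3∣I∣≤nearPairs+1 ∣J∣≡1+∣I∣ with ℕₚ.m≤n⇒m<n∨m≡n x≤y | ℕₚ.m≤n⇒m<n∨m≡n h≤k
      ... | inj₁ x<y | _        = from∑links (+-bound₃′ 0 0 1 (≤0+ (∣I∣≤links₋ x<y)) (≤0+ ∣I∣≤links₀) ∣I∣≤links₊+1)
      ... | inj₂ _   | inj₁ h<k = from∑links (+-bound₃′ 1 0 0 ∣I∣≤links₋+1 (≤0+ ∣I∣≤links₀) (≤0+ (∣I∣≤links₊ h<k)))
      ... | inj₂ x≡y | inj₂ h≡k = ⊥-elim (ℕₚ.<⇒≱ (ℕₚ.≤-reflexive (sym ∣J∣≡1+∣I∣))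
        (⊆⇒length≤ ℤ._≟_ I J uI uJ (J⊆I (ℕₚ.≤-reflexive (sym x≡y)) (ℕₚ.≤-reflexive (sym h≡k)))))

      3∣I∣≤nearPairs : 2 + length I ≤ℕ length J → 3 * length I ≤ℕ nearPairs I J
      3∣I∣≤nearPairs 2+∣I∣≤∣J∣ with ℕₚ.m≤n⇒m<n∨m≡n x≤y | ℕₚ.m≤n⇒m<n∨m≡n h≤k
      ... | inj₂ x≡y | _        = ⊥-elim (¬J⊆∷I 2+∣I∣≤∣J∣ (+ k) (J⊆k∷I x≡y))
      ... | inj₁ _   | inj₂ h≡k = ⊥-elim (¬J⊆∷I 2+∣I∣≤∣J∣ (- + y) (J⊆-y∷I h≡k))
      ... | inj₁ x<y | inj₁ h<k = subst (3 * length I ≤ℕ_) (ℕₚ.+-identityʳ _)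
        (from∑links (+-bound₃′ 0 0 0 (≤0+ (∣I∣≤links₋ x<y)) (≤0+ ∣I∣≤links₀) (≤0+ (∣I∣≤links₊ h<k))))

  Central : List ℤ → Set
  Central I = (∀ {u} → u ∉ I) ⊎ CentralInterval I

  private
    nonempty-central : ∀ {I} → Central I → 0 <ℕ length I → CentralInterval I
    nonempty-central             (inj₂ cI)    _ = cI
    nonempty-central {u ∷ _}     (inj₁ empty) _ = ⊥-elim (empty (here refl))

    ≡∨≡suc∨2+≤ : ∀ {m n} → m ≤ℕ n → n ≡ m ⊎ n ≡ suc m ⊎ 2 + m ≤ℕ n
    ≡∨≡suc∨2+≤ m≤n with ℕₚ.m≤n⇒m<n∨m≡n m≤n
    ... | inj₂ m≡n = inj₁ (sym m≡n)
    ... | inj₁ m<n with ℕₚ.m≤n⇒m<n∨m≡n m<n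
    ...   | inj₂ 1+m≡n = inj₂ (inj₁ (sym 1+m≡n))
    ...   | inj₁ 1+m<n = inj₂ (inj₂ 1+m<n)

    nearPairs-≤-central-≤ : ∀ {A B I J} → Unique A → Unique B → Unique I → Unique J →
      length I ≡ length A → length J ≡ length B → Central I → Central J →
      length A ≤ℕ length B → nearPairs A B ≤ℕ nearPairs I J
    nearPairs-≤-central-≤ {[]} _ _ _ _ _ _ _ _ _ = z≤n
    nearPairs-≤-central-≤ {A@(_ ∷ _)} {B} {I} {J} uA uB uI uJ ∣I∣≡∣A∣ ∣J∣≡∣B∣ cI cJ ∣A∣≤∣B∣ =
      by-gap (≡∨≡suc∨2+≤ ∣A∣≤∣B∣)
      where
      nonemptyI : 0 <ℕ length I
      nonemptyI = subst (0 <ℕ_) (sym ∣I∣≡∣A∣) (s≤s z≤n)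
      nonemptyJ : 0 <ℕ length J
      nonemptyJ = subst (0 <ℕ_) (sym ∣J∣≡∣B∣) (ℕₚ.≤-trans (s≤s z≤n) ∣A∣≤∣B∣)
      open Intervals uI uJ (nonempty-central cI nonemptyI) (nonempty-central cJ nonemptyJ)
      ends = ∣I∣≤∣J∣⇒ends≤ (subst₂ _≤ℕ_ (sym ∣I∣≡∣A∣) (sym ∣J∣≡∣B∣) ∣A∣≤∣B∣)
      x≤y = proj₁ ends
      h≤k = proj₂ ends
      3∣A∣≡3∣I∣ : 3 * length A ≡ 3 * length I
      3∣A∣≡3∣I∣ = cong (3 *_) (sym ∣I∣≡∣A∣)
      open ℕₚ.≤-Reasoning
      by-gap : length B ≡ length A ⊎ length B ≡ suc (length A) ⊎ 2 + length A ≤ℕ length B →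
               nearPairs A B ≤ℕ nearPairs I J
      by-gap (inj₁ ∣B∣≡∣A∣) = ℕₚ.+-cancelʳ-≤ 2 _ _ (begin
        nearPairs A B + 2  ≤⟨ nearPairs+2≤3∣A∣ uA uB ∣B∣≡∣A∣ (here refl) ⟩
        3 * length A       ≡⟨ 3∣A∣≡3∣I∣ ⟩
        3 * length I       ≤⟨ 3∣I∣≤nearPairs+2 x≤y h≤k ⟩
        nearPairs I J + 2  ∎)
      by-gap (inj₂ (inj₁ ∣B∣≡1+∣A∣)) = ℕₚ.+-cancelʳ-≤ 1 _ _ (begin
        nearPairs A B + 1  ≤⟨ nearPairs+1≤3∣A∣ uA uB ∣B∣≡1+∣A∣ (here refl) ⟩
        3 * length A       ≡⟨ 3∣A∣≡3∣I∣ ⟩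
        3 * length I       ≤⟨ 3∣I∣≤nearPairs+1 x≤y h≤k
                                (trans ∣J∣≡∣B∣ (trans ∣B∣≡1+∣A∣ (cong suc (sym ∣I∣≡∣A∣)))) ⟩
        nearPairs I J + 1  ∎)
      by-gap (inj₂ (inj₂ 2+∣A∣≤∣B∣)) = begin
        nearPairs A B      ≤⟨ nearPairs≤3∣A∣ A B ⟩
        3 * length A       ≡⟨ 3∣A∣≡3∣I∣ ⟩
        3 * length I       ≤⟨ 3∣I∣≤nearPairs x≤y h≤k
                                (subst₂ (λ m n → 2 + m ≤ℕ n) (sym ∣I∣≡∣A∣) (sym ∣J∣≡∣B∣) 2+∣A∣≤∣B∣) ⟩
        nearPairs I J      ∎

  nearPairs-≤-central : ∀ {A B I J} → Unique A → Unique B → Unique I → Unique J →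
    length I ≡ length A → length J ≡ length B → Central I → Central J →
    nearPairs A B ≤ℕ nearPairs I J
  nearPairs-≤-central {A} {B} uA uB uI uJ ∣I∣≡∣A∣ ∣J∣≡∣B∣ cI cJ with ℕₚ.≤-total (length A) (length B)
  ... | inj₁ ∣A∣≤∣B∣ = nearPairs-≤-central-≤ uA uB uI uJ ∣I∣≡∣A∣ ∣J∣≡∣B∣ cI cJ ∣A∣≤∣B∣
  ... | inj₂ ∣B∣≤∣A∣ = subst₂ _≤ℕ_ (nearPairs-swap uB uA) (nearPairs-swap uJ uI)
    (nearPairs-≤-central-≤ uB uA uJ uI ∣J∣≡∣B∣ ∣I∣≡∣A∣ cJ cI ∣B∣≤∣A∣)

module Lattice where

  open import Defs
  open FiniteSums
  open OneDimensional
  open import Data.Nat as ℕ using (ℕ; suc; _+_; _*_; _≤_; z≤n)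
  import Data.Nat.Properties as ℕₚ
  open import Data.Integer as ℤ using (ℤ; +_; -_)
  import Data.Integer.Properties as ℤₚ
  import Data.Integer.Tactic.RingSolver as ℤSolver
  open import Data.Fin using (Fin; zero; suc)
  open import Data.Vec using ([]; _∷_; zipWith; insertAt; removeAt; lookup)
  open import Data.Vec.Properties using (≡-dec; removeAt-insertAt; insertAt-removeAt; insertAt-lookup)
  open import Data.List as List using (List; []; _∷_; length; filter; _++_; deduplicate)
  import Data.List.Properties as Listₚ
  open import Data.List.Membership.Propositional using (_∈_; _∉_)
  open import Data.List.Membership.Propositional.Properties
    using (∈-map⁺; ∈-map⁻; ∈-filter⁺; ∈-filter⁻; ∈-concatMap⁻; ∈-++⁺ˡ; ∈-++⁺ʳ; ∈-deduplicate⁺)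
  import Data.List.Membership.DecPropositional as DecMembership
  open import Data.List.Relation.Unary.Any using (Any; here; there)
  import Data.List.Relation.Unary.All as All
  open import Data.List.Relation.Unary.AllPairs using ([]; _∷_)
  open import Data.List.Relation.Unary.Unique.Propositional using (Unique)
  open import Data.List.Relation.Unary.Unique.DecPropositional.Properties using (deduplicate-!)
  open import Data.Product using (∃₂; _×_; _,_; proj₁; proj₂)
  open import Data.Sum using (_⊎_; inj₁; inj₂)
  open import Data.Empty using (⊥-elim)
  open import Function.Bundles using (Equivalence; _⇔_)
  open import Relation.Nullary using (Dec; yes; no)
  open import Relation.Nullary.Decidable using (_×-dec_; ¬?)
  open import Relation.Binary.PropositionalEquality

  open DecMembership ℤ._≟_ using (_∈?_)

  module _ {n : ℕ} where
    open DecMembership (≡-dec {n = n} ℤ._≟_) public using () renaming (_∈?_ to _∈ᵖ?_)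

  _+ᵥ_ : ∀ {n} → Point n → Point n → Point n
  _+ᵥ_ = zipWith ℤ._+_

  dist∞≡0⇒≡ : ∀ {n} (x y : Point n) → dist∞ x y ≡ 0 → x ≡ y
  dist∞≡0⇒≡ []      []      _ = refl
  dist∞≡0⇒≡ (a ∷ x) (b ∷ y) d≡0 = cong₂ _∷_
    (ℤₚ.i-j≡0⇒i≡j a b (ℤₚ.∣i∣≡0⇒i≡0 (ℕₚ.n≤0⇒n≡0 (subst (ℤ.∣ a ℤ.- b ∣ ≤_) d≡0 (ℕₚ.m≤m⊔n _ _)))))
    (dist∞≡0⇒≡ x y (ℕₚ.n≤0⇒n≡0 (subst (dist∞ x y ≤_) d≡0 (ℕₚ.m≤n⊔m _ _))))

  ∈-box⁻ : ∀ {n} {d : Point (suc n)} → d ∈ box (suc n) → ∃₂ λ δ e → δ ∈ steps × e ∈ box n × d ≡ δ ∷ e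
  ∈-box⁻ {n} d∈ = lift (∈-concatMap⁻ (λ δ → List.map (δ ∷_) (box n)) {xs = steps} d∈)
    where
    lift : ∀ {d δs} → Any (λ δ → d ∈ List.map (δ ∷_) (box n)) δs → ∃₂ λ δ e → δ ∈ δs × e ∈ box n × d ≡ δ ∷ e
    lift (here d∈) with ∈-map⁻ (_ ∷_) d∈
    ... | e , e∈ , refl = _ , e , here refl , e∈ , refl
    lift (there d∈) with lift d∈
    ... | δ , e , δ∈ , e∈ , d≡ = δ , e , there δ∈ , e∈ , d≡

  ∣a-[a+δ]∣≤1 : ∀ a {δ} → δ ∈ steps → ℤ.∣ a ℤ.- (a ℤ.+ δ) ∣ ≤ 1
  ∣a-[a+δ]∣≤1 a {δ} δ∈ = subst (_≤ 1) (cong ℤ.∣_∣ (sym (a-[a+δ]≡-δ a δ))) (∣-δ∣≤1 δ∈)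
    where
    a-[a+δ]≡-δ : ∀ a δ → a ℤ.- (a ℤ.+ δ) ≡ - δ
    a-[a+δ]≡-δ = ℤSolver.solve-∀
    ∣-δ∣≤1 : ∀ {δ} → δ ∈ steps → ℤ.∣ - δ ∣ ≤ 1
    ∣-δ∣≤1 (here refl)                 = ℕₚ.≤-refl
    ∣-δ∣≤1 (there (here refl))         = z≤n
    ∣-δ∣≤1 (there (there (here refl))) = ℕₚ.≤-refl

  dist∞-+ᵥ≤1 : ∀ {n} (x : Point n) {d} → d ∈ box n → dist∞ x (x +ᵥ d) ≤ 1
  dist∞-+ᵥ≤1 []      {[]} _ = z≤n
  dist∞-+ᵥ≤1 (a ∷ x) d∈ with ∈-box⁻ d∈
  ... | δ , e , δ∈ , e∈ , refl = ℕₚ.⊔-lub (∣a-[a+δ]∣≤1 a δ∈) (dist∞-+ᵥ≤1 x e∈)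

  innerPairs : ∀ {n} → List (Point n) → ℕ
  innerPairs {n} S = ∑[ x ∈ S ] ∑[ d ∈ box n ] 𝟙 (x +ᵥ d ∈ᵖ? S)

  module _ {n : ℕ} (S : List (Point n)) where

    private
      exits? : (x y : Point n) → Dec (dist∞ x y ≡ 1 × y ∉ S)
      exits? x y = (dist∞ x y ℕ.≟ 1) ×-dec ¬? (y ∈ᵖ? S)

      ∣∂ₑ∣≡∑exits : ∣∂ₑ∣ S ≡ ∑[ x ∈ S ] ∑[ d ∈ box n ] 𝟙 (exits? x (x +ᵥ d))
      ∣∂ₑ∣≡∑exits = begin
        ∣∂ₑ∣ S
          ≡⟨ sym (∑1≡length (boundaryEdges S)) ⟩
        ∑[ _ ∈ boundaryEdges S ] 1
          ≡⟨ ∑-concatMap _ S (λ _ → 1) ⟩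
        ∑[ x ∈ S ] ∑[ _ ∈ List.map (x ,_) (exits x) ] 1
          ≡⟨ ∑-cong S (λ x _ → trans (∑-map (x ,_) (exits x) (λ _ → 1)) (∑1≡length (exits x))) ⟩
        ∑[ x ∈ S ] length (exits x)
          ≡⟨ ∑-cong S (λ x _ → length-filter (exits? x) (candidates x)) ⟩
        ∑[ x ∈ S ] ∑[ y ∈ candidates x ] 𝟙 (exits? x y)
          ≡⟨ ∑-cong S (λ x _ → ∑-map (x +ᵥ_) (box n) (λ y → 𝟙 (exits? x y))) ⟩
        ∑[ x ∈ S ] ∑[ d ∈ box n ] 𝟙 (exits? x (x +ᵥ d))
          ∎
        where
        open ≡-Reasoning
        exits : Point n → List (Point n)
        exits x = filter (exits? x) (candidates x)

      exit-or-inner : ∀ {x d} → x ∈ S → d ∈ box n → 𝟙 (exits? x (x +ᵥ d)) + 𝟙 (x +ᵥ d ∈ᵖ? S) ≡ 1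
      exit-or-inner {x} {d} x∈S d∈box with dist∞ x (x +ᵥ d) ℕ.≟ 1 | x +ᵥ d ∈ᵖ? S
      ... | yes _   | yes _  = refl
      ... | yes _   | no _   = refl
      ... | no _    | yes _  = refl
      ... | no dist≢1 | no x+d∉S = ⊥-elim (x+d∉S (subst (_∈ S) (dist∞≡0⇒≡ x (x +ᵥ d) dist≡0) x∈S))
        where
        dist≡0 : dist∞ x (x +ᵥ d) ≡ 0
        dist≡0 = ℕₚ.n≤0⇒n≡0 (ℕₚ.≤-pred (ℕₚ.≤∧≢⇒< (dist∞-+ᵥ≤1 x d∈box) dist≢1))

    ∣∂ₑ∣+innerPairs≡ : ∣∂ₑ∣ S + innerPairs S ≡ length S * length (box n)
    ∣∂ₑ∣+innerPairs≡ = begin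
      ∣∂ₑ∣ S + innerPairs S
        ≡⟨ cong (_+ innerPairs S) ∣∂ₑ∣≡∑exits ⟩
      ∑[ x ∈ S ] ∑[ d ∈ box n ] 𝟙 (exits? x (x +ᵥ d)) + innerPairs S
        ≡⟨ sym (∑-+ S _ _) ⟩
      ∑[ x ∈ S ] (∑[ d ∈ box n ] 𝟙 (exits? x (x +ᵥ d)) + ∑[ d ∈ box n ] 𝟙 (x +ᵥ d ∈ᵖ? S))
        ≡⟨ ∑-cong S (λ x x∈S → trans (sym (∑-+ (box n) _ _)) (∑-cong (box n) (λ d d∈box → exit-or-inner x∈S d∈box))) ⟩
      ∑[ x ∈ S ] ∑[ d ∈ box n ] 1
        ≡⟨ ∑-cong S (λ x _ → ∑1≡length (box n)) ⟩
      ∑[ x ∈ S ] length (box n)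
        ≡⟨ ∑-const S (length (box n)) ⟩
      length S * length (box n)
        ∎
      where open ≡-Reasoning

  ∑-box-suc : ∀ m (h : Point (suc m) → ℕ) → ∑ (box (suc m)) h ≡ ∑[ δ ∈ steps ] ∑[ e ∈ box m ] h (δ ∷ e)
  ∑-box-suc m h = trans (∑-concatMap (λ δ → List.map (δ ∷_) (box m)) steps h)
                        (∑-cong steps (λ δ _ → ∑-map (δ ∷_) (box m) h))

  ∑-box-insertAt : ∀ m (i : Fin (suc m)) (h : Point (suc m) → ℕ) →
                   ∑ (box (suc m)) h ≡ ∑[ e ∈ box m ] ∑[ δ ∈ steps ] h (insertAt e i δ)
  ∑-box-insertAt m       zero    h = trans (∑-box-suc m h) (∑-comm steps (box m) (λ δ e → h (δ ∷ e)))
  ∑-box-insertAt (suc m) (suc i) h = begin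
    ∑ (box (suc (suc m))) h
      ≡⟨ ∑-box-suc (suc m) h ⟩
    ∑[ δ ∈ steps ] ∑[ e ∈ box (suc m) ] h (δ ∷ e)
      ≡⟨ ∑-cong steps (λ δ _ → ∑-box-insertAt m i (λ e → h (δ ∷ e))) ⟩
    ∑[ δ ∈ steps ] ∑[ e ∈ box m ] ∑[ δ′ ∈ steps ] h (δ ∷ insertAt e i δ′)
      ≡⟨ sym (∑-box-suc m (λ e → ∑[ δ′ ∈ steps ] h (insertAt e (suc i) δ′))) ⟩
    ∑[ e ∈ box (suc m) ] ∑[ δ ∈ steps ] h (insertAt e (suc i) δ)
      ∎
    where open ≡-Reasoning

  insertAt-+ᵥ : ∀ {m} (i : Fin (suc m)) (p e : Point m) (u δ : ℤ) →
                insertAt p i u +ᵥ insertAt e i δ ≡ insertAt (p +ᵥ e) i (u ℤ.+ δ)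
  insertAt-+ᵥ zero    p       e       u δ = refl
  insertAt-+ᵥ (suc i) (a ∷ p) (b ∷ e) u δ = cong (a ℤ.+ b ∷_) (insertAt-+ᵥ i p e u δ)

  module Fibres {m : ℕ} (i : Fin (suc m)) where

    private
      above? : (p : Point m) (v : Point (suc m)) → Dec (removeAt v i ≡ p)
      above? p v = ≡-dec ℤ._≟_ (removeAt v i) p

      insertAt-removeAt′ : ∀ {p} (v : Point (suc m)) → removeAt v i ≡ p → insertAt p i (lookup v i) ≡ v
      insertAt-removeAt′ v refl = insertAt-removeAt v i

    fibre : List (Point (suc m)) → Point m → List ℤ
    fibre S p = List.map (λ v → lookup v i) (filter (above? p) S)

    length-fibre : ∀ S p → length (fibre S p) ≡ fibreSize i p S
    length-fibre S p = Listₚ.length-map (λ v → lookup v i) (filter (above? p) S)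

    ∈-fibre⁺ : ∀ {S p u} → insertAt p i u ∈ S → u ∈ fibre S p
    ∈-fibre⁺ {S} {p} {u} v∈S = subst (_∈ fibre S p) (insertAt-lookup p i u)
      (∈-map⁺ (λ v → lookup v i) (∈-filter⁺ (above? p) v∈S (removeAt-insertAt p i u)))

    ∈-fibre⁻ : ∀ {S p u} → u ∈ fibre S p → insertAt p i u ∈ S
    ∈-fibre⁻ {S} {p} u∈ with ∈-map⁻ (λ v → lookup v i) u∈
    ... | v , v∈ , refl with ∈-filter⁻ (above? p) v∈
    ... | v∈S , v-above-p = subst (_∈ S) (sym (insertAt-removeAt′ v v-above-p)) v∈S

    fibre-unique : ∀ {S} p → Unique S → Unique (fibre S p)
    fibre-unique {[]}    p []           = []
    fibre-unique {v ∷ S} p (v∉S ∷ uS) with above? p v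
    ... | no  _         = fibre-unique p uS
    ... | yes v-above-p = All.tabulate distinct ∷ fibre-unique p uS
      where
      distinct : ∀ {u} → u ∈ fibre S p → lookup v i ≢ u
      distinct u∈ v[i]≡u with ∈-map⁻ (λ w → lookup w i) u∈
      ... | w , w∈ , refl with ∈-filter⁻ (above? p) w∈
      ... | w∈S , w-above-p = All.lookup v∉S w∈S (begin
        v                         ≡⟨ sym (insertAt-removeAt′ v v-above-p) ⟩
        insertAt p i (lookup v i) ≡⟨ cong (insertAt p i) v[i]≡u ⟩
        insertAt p i (lookup w i) ≡⟨ insertAt-removeAt′ w w-above-p ⟩
        w                         ∎)
        where open ≡-Reasoning

    module _ (L : List (Point m)) (uL : Unique L) {S : List (Point (suc m))}
             (L-covers : ∀ {v} → v ∈ S → removeAt v i ∈ L) where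

      ∑-by-fibres : (h : Point (suc m) → ℕ) → ∑ S h ≡ ∑[ p ∈ L ] ∑[ u ∈ fibre S p ] h (insertAt p i u)
      ∑-by-fibres h = begin
        ∑ S h
          ≡⟨ ∑-cong S (λ v v∈S → sym (trans (∑-pick _≟ᵥ_ L uL (removeAt v i) (λ _ → h v))
               (trans (cong (_* h v) (𝟙-yes (removeAt v i ∈ᵖ? L) (L-covers v∈S))) (ℕₚ.*-identityˡ (h v))))) ⟩
        ∑[ v ∈ S ] ∑[ p ∈ L ] (𝟙 (p ≟ᵥ removeAt v i) * h v)
          ≡⟨ ∑-comm S L _ ⟩
        ∑[ p ∈ L ] ∑[ v ∈ S ] (𝟙 (p ≟ᵥ removeAt v i) * h v)
          ≡⟨ ∑-cong L (λ p _ → ∑-cong S (λ v _ → cong (_* h v) (𝟙-cong sym sym (p ≟ᵥ removeAt v i) (above? p v)))) ⟩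
        ∑[ p ∈ L ] ∑[ v ∈ S ] (𝟙 (above? p v) * h v)
          ≡⟨ ∑-cong L (λ p _ → sym (∑-filter (above? p) S h)) ⟩
        ∑[ p ∈ L ] ∑ (filter (above? p) S) h
          ≡⟨ ∑-cong L (λ p _ → ∑-cong (filter (above? p) S) (λ v v∈ →
               cong h (sym (insertAt-removeAt′ v (proj₂ (∈-filter⁻ (above? p) {xs = S} v∈)))))) ⟩
        ∑[ p ∈ L ] ∑[ v ∈ filter (above? p) S ] h (insertAt p i (lookup v i))
          ≡⟨ ∑-cong L (λ p _ → sym (∑-map (λ v → lookup v i) (filter (above? p) S) (λ u → h (insertAt p i u)))) ⟩
        ∑[ p ∈ L ] ∑[ u ∈ fibre S p ] h (insertAt p i u)
          ∎
        where
        open ≡-Reasoning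
        _≟ᵥ_ = ≡-dec {n = m} ℤ._≟_

      length-by-fibres : length S ≡ ∑[ p ∈ L ] fibreSize i p S
      length-by-fibres = begin
        length S                               ≡⟨ sym (∑1≡length S) ⟩
        ∑[ _ ∈ S ] 1                           ≡⟨ ∑-by-fibres (λ _ → 1) ⟩
        ∑[ p ∈ L ] ∑[ _ ∈ fibre S p ] 1        ≡⟨ ∑-cong L (λ p _ → trans (∑1≡length (fibre S p)) (length-fibre S p)) ⟩
        ∑[ p ∈ L ] fibreSize i p S             ∎
        where open ≡-Reasoning

      innerPairs-by-fibres : innerPairs S ≡ ∑[ e ∈ box m ] ∑[ p ∈ L ] nearPairs (fibre S p) (fibre S (p +ᵥ e))
      innerPairs-by-fibres = begin
        innerPairs S
          ≡⟨ ∑-cong S (λ v _ → ∑-box-insertAt m i (λ d → 𝟙 (v +ᵥ d ∈ᵖ? S))) ⟩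
        ∑[ v ∈ S ] ∑[ e ∈ box m ] steps-into e v
          ≡⟨ ∑-comm S (box m) (λ v e → steps-into e v) ⟩
        ∑[ e ∈ box m ] ∑ S (steps-into e)
          ≡⟨ ∑-cong (box m) (λ e _ → ∑-by-fibres (steps-into e)) ⟩
        ∑[ e ∈ box m ] ∑[ p ∈ L ] ∑[ u ∈ fibre S p ] steps-into e (insertAt p i u)
          ≡⟨ ∑-cong (box m) (λ e _ → ∑-cong L (λ p _ → ∑-cong (fibre S p) (λ u _ → ∑-cong steps (λ δ _ → in-fibre e p u δ)))) ⟩
        ∑[ e ∈ box m ] ∑[ p ∈ L ] nearPairs (fibre S p) (fibre S (p +ᵥ e))
          ∎
        where
        open ≡-Reasoning
        steps-into : Point m → Point (suc m) → ℕ
        steps-into e v = ∑[ δ ∈ steps ] 𝟙 (v +ᵥ insertAt e i δ ∈ᵖ? S)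
        in-fibre : ∀ e p u δ → 𝟙 (insertAt p i u +ᵥ insertAt e i δ ∈ᵖ? S) ≡ 𝟙 (u ℤ.+ δ ∈? fibre S (p +ᵥ e))
        in-fibre e p u δ rewrite insertAt-+ᵥ i p e u δ =
          𝟙-cong ∈-fibre⁺ ∈-fibre⁻ (insertAt (p +ᵥ e) i (u ℤ.+ δ) ∈ᵖ? S) (u ℤ.+ δ ∈? fibre S (p +ᵥ e))

    private
      interval : ∀ {T p} a b → b ≡ a ⊎ b ≡ suc a →
                 (∀ x → (insertAt p i x ∈ T) ⇔ (- + a ℤ.≤ x × x ℤ.≤ + b)) → CentralInterval (fibre T p)
      interval a b b≡ ↔ab = record
        { left     = a
        ; right    = b
        ; right≡   = b≡
        ; bounded  = λ u∈ → Equivalence.to (↔ab _) (∈-fibre⁻ u∈)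
        ; complete = λ -a≤u u≤b → ∈-fibre⁺ (Equivalence.from (↔ab _) (-a≤u , u≤b))
        }

    central-fibre : ∀ {T} p → CentrallyCompressed i p T → Central (fibre T p)
    central-fibre p (inj₁ empty)           = inj₁ (λ u∈ → empty _ (∈-fibre⁻ u∈))
    central-fibre p (inj₂ (inj₁ (a , ↔a))) = inj₂ (interval a a (inj₁ refl) ↔a)
    central-fibre p (inj₂ (inj₂ (a , ↔a))) = inj₂ (interval a (suc a) (inj₂ refl) ↔a)

  module _ {m : ℕ} (i : Fin (suc m)) {S T : List (Point (suc m))} (uS : Unique S) (uT : Unique T)
           (compressed : IsCentralCompression i S T) where

    open Fibres i

    private
      _≟ᵥ_ = ≡-dec {n = m} ℤ._≟_

      L : List (Point m)
      L = deduplicate _≟ᵥ_ (List.map (λ v → removeAt v i) (S ++ T))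

      L-covers-S : ∀ {v} → v ∈ S → removeAt v i ∈ L
      L-covers-S v∈S = ∈-deduplicate⁺ _≟ᵥ_ (∈-map⁺ (λ v → removeAt v i) (∈-++⁺ˡ v∈S))

      L-covers-T : ∀ {v} → v ∈ T → removeAt v i ∈ L
      L-covers-T v∈T = ∈-deduplicate⁺ _≟ᵥ_ (∈-map⁺ (λ v → removeAt v i) (∈-++⁺ʳ S v∈T))

      uL : Unique L
      uL = deduplicate-! _≟ᵥ_ (List.map (λ v → removeAt v i) (S ++ T))

      same-fibre-sizes : ∀ p → length (fibre T p) ≡ length (fibre S p)
      same-fibre-sizes p = trans (length-fibre T p) (trans (proj₁ (compressed p)) (sym (length-fibre S p)))

    length-compression : length S ≡ length T
    length-compression = begin
      length S                   ≡⟨ length-by-fibres L uL L-covers-S ⟩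
      ∑[ p ∈ L ] fibreSize i p S ≡⟨ ∑-cong L (λ p _ → sym (proj₁ (compressed p))) ⟩
      ∑[ p ∈ L ] fibreSize i p T ≡⟨ sym (length-by-fibres L uL L-covers-T) ⟩
      length T                   ∎
      where open ≡-Reasoning

    innerPairs-compression : innerPairs S ≤ innerPairs T
    innerPairs-compression = begin
      innerPairs S
        ≡⟨ innerPairs-by-fibres L uL L-covers-S ⟩
      ∑[ e ∈ box m ] ∑[ p ∈ L ] nearPairs (fibre S p) (fibre S (p +ᵥ e))
        ≤⟨ ∑-mono (box m) (λ e _ → ∑-mono L (λ p _ → nearPairs-≤-central
             (fibre-unique p uS) (fibre-unique (p +ᵥ e) uS) (fibre-unique p uT) (fibre-unique (p +ᵥ e) uT)
             (same-fibre-sizes p) (same-fibre-sizes (p +ᵥ e))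
             (central-fibre p (proj₂ (compressed p))) (central-fibre (p +ᵥ e) (proj₂ (compressed (p +ᵥ e)))))) ⟩
      ∑[ e ∈ box m ] ∑[ p ∈ L ] nearPairs (fibre T p) (fibre T (p +ᵥ e))
        ≡⟨ innerPairs-by-fibres L uL L-covers-T ⟨
      innerPairs T
        ∎
      where open ℕₚ.≤-Reasoning

open import Defs
open import Data.Nat using (ℕ; suc; _≤_; _+_; _*_)
open import Data.Nat.Properties using (+-cancelʳ-≤; +-monoʳ-≤; module ≤-Reasoning)
open import Data.Fin using (Fin)
open import Data.List using (List; length)
open import Data.List.Relation.Unary.Unique.Propositional using (Unique)
open import Relation.Binary.PropositionalEquality using (cong)
open Lattice

proposition1 : (m : ℕ) (i : Fin (suc m)) (S T : List (Point (suc m))) →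
    Unique S → Unique T → IsCentralCompression i S T →
    ∣∂ₑ∣ T ≤ ∣∂ₑ∣ S
proposition1 m i S T uS uT compressed = +-cancelʳ-≤ (innerPairs S) (∣∂ₑ∣ T) (∣∂ₑ∣ S) (begin
  ∣∂ₑ∣ T + innerPairs S            ≤⟨ +-monoʳ-≤ (∣∂ₑ∣ T) (innerPairs-compression i uS uT compressed) ⟩
  ∣∂ₑ∣ T + innerPairs T            ≡⟨ ∣∂ₑ∣+innerPairs≡ T ⟩
  length T * length (box (suc m))  ≡⟨ cong (_* length (box (suc m))) (length-compression i uS uT compressed) ⟨
  length S * length (box (suc m))  ≡⟨ ∣∂ₑ∣+innerPairs≡ S ⟨
  ∣∂ₑ∣ S + innerPairs S            ∎)
  where open ≤-Reasoning
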